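{- Let $k$ be an infinite field with $\mathrm{char}(k)\neq 2,3$, let $V_d$ be a $k$-vector space of dimension $d$ with basis $\{e_1,\dots,e_d\}$, and write $t(a,b,c,d')=a\otimes b\otimes c\otimes d'\in V_d^{\otimes 4}$ for the simple tensor whose factors in the positions $(1,2,3),(1,2,4),(1,3,4),(2,3,4)$ are $a,b,c,d'$ respectively. Then $\mathcal{E}^{S^3}_{V_d}[4]$ is the subspace of $\mathcal{T}^{S^3}_{V_d}[4]=V_d^{\otimes 4}$ linearly spanned by the following elements: (1) $t(e_i,e_i,e_i,e_i)$ for all $1\le i\le d$; (2) $t(e_i,e_i,e_i,e_j)+t(e_i,e_i,e_j,e_i)+t(e_i,e_j,e_i,e_i)+t(e_j,e_i,e_i,e_i)$ for all $1\le i\neq j\le d$; (3) $t(e_i,e_i,e_j,e_j)+t(e_i,e_j,e_i,e_j)+t(e_i,e_j,e_j,e_i)+t(e_j,e_i,e_i,e_j)+t(e_j,e_i,e_j,e_i)+t(e_j,e_j,e_i,e_i)$ for all $1\le i<j\le d$; (4) for all $1\le i\le d$ and $1\le j<k\le d$ with $i\neq j$, $i\neq k$: $\sum_{\sigma}\big(t(e_i,e_i,e_{\sigma(j)},e_{\sigma(k)})+t(e_i,e_{\sigma(j)},e_i,e_{\sigma(k)})+t(e_i,e_{\sigma(j)},e_{\sigma(k)},e_i)+t(e_{\sigma(j)},e_i,e_i,e_{\sigma(k)})+t(e_{\sigma(j)},e_i,e_{\sigma(k)},e_i)+t(e_{\sigma(j)},e_{\sigma(k)},e_i,e_i)\big)$,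 where $\sigma$ runs over the two permutations of the set $\{j,k\}$; (5) for all $1\le i<j<k<l\le d$: $\sum_{\sigma}t(e_{\sigma(i)},e_{\sigma(j)},e_{\sigma(k)},e_{\sigma(l)})$, where $\sigma$ runs over all permutations of the set $\{i,j,k,l\}$.
   Context: For a $k$-vector space $V$ and $n\ge 0$, $\mathcal{T}^{S^3}_V[n]=V^{\otimes\binom{n}{3}}$, where the tensor factors are indexed by the triples $(i,j,k)$ with $1\le i<j<k\le n$; a simple tensor is written $\otimes_{1\le i<j<k\le n}(v_{i,j,k})$ with $v_{i,j,k}\in V$. $\mathcal{E}^{S^3}_V[n]$ is the subspace of $\mathcal{T}^{S^3}_V[n]$ spanned by all simple tensors $\otimes_{1\le i<j<k\le n}(v_{i,j,k})$ for which there exist $1\le x<y<z<t\le n$ with $v_{x,y,z}=v_{x,y,t}=v_{x,z,t}=v_{y,z,t}$. -}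

module Defs where

open import Level using (Level; _⊔_)
open import Algebra.Bundles using (CommutativeRing)
open import Data.Nat using (ℕ)
open import Data.Fin using (Fin; _<_; _≟_)
open import Data.Bool using (if_then_else_)
open import Data.List using (List; []; _∷_; map; foldr)
open import Data.List.Relation.Unary.All using (All)
open import Data.Product using (Σ; ∃; _×_; _,_)
open import Relation.Nullary using (¬_; does)
open import Relation.Binary.PropositionalEquality using (_≡_)

record IsField {c ℓ : Level} (R : CommutativeRing c ℓ) : Set (c ⊔ ℓ) where
  open CommutativeRing R
  field
    1≉0     : ¬ (1# ≈ 0#)
    inverse : ∀ x → ¬ (x ≈ 0#) → Σ Carrier (λ y → x * y ≈ 1#)

Infinite : {c ℓ : Level} (R : CommutativeRing c ℓ) → Set (c ⊔ ℓ)
Infinite R = ∀ (xs : List Carrier) → ∃ (λ x → All (λ y → ¬ (x ≈ y)) xs)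
  where open CommutativeRing R

CharNot2 : {c ℓ : Level} (R : CommutativeRing c ℓ) → Set ℓ
CharNot2 R = ¬ (1# + 1# ≈ 0#)
  where open CommutativeRing R

CharNot3 : {c ℓ : Level} (R : CommutativeRing c ℓ) → Set ℓ
CharNot3 R = ¬ (1# + 1# + 1# ≈ 0#)
  where open CommutativeRing R

-- Linear algebra for V_d = k^d (coordinates w.r.t. the basis e_1..e_d,
-- indexed by Fin d) and T^{S^3}_{V_d}[4] = V_d^{⊗4}, whose tensor factors
-- are indexed, in this order, by the triples (1,2,3),(1,2,4),(1,3,4),(2,3,4).
-- V_d^{⊗4} is modelled by its coordinates in the basis e_p⊗e_q⊗e_r⊗e_s.
module Tensor {c ℓ : Level} (R : CommutativeRing c ℓ) (d : ℕ) where
  open CommutativeRing R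

  V : Set c
  V = Fin d → Carrier

  e : Fin d → V
  e i j = if does (i ≟ j) then 1# else 0#

  _≈V_ : V → V → Set ℓ
  u ≈V v = ∀ p → u p ≈ v p

  T4 : Set c
  T4 = Fin d → Fin d → Fin d → Fin d → Carrier

  _≋_ : T4 → T4 → Set ℓ
  u ≋ v = ∀ p q r s → u p q r s ≈ v p q r s

  zeroT : T4
  zeroT _ _ _ _ = 0#

  _⊕_ : T4 → T4 → T4
  (u ⊕ v) p q r s = u p q r s + v p q r s

  _·_ : Carrier → T4 → T4
  (a · u) p q r s = a * u p q r s

  infixl 6 _⊕_

  t : V → V → V → V → T4
  t a b c' d' p q r s = a p * b q * c' r * d' s

  data Span {p : Level} (P : T4 → Set p) : T4 → Set (c ⊔ ℓ ⊔ p) where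
    span-zero  : Span P zeroT
    span-gen   : ∀ {u} → P u → Span P u
    span-add   : ∀ {u v} → Span P u → Span P v → Span P (u ⊕ v)
    span-scale : ∀ a {u} → Span P u → Span P (a · u)
    span-resp  : ∀ {u v} → u ≋ v → Span P u → Span P v

  -- generators of E^{S^3}_{V_d}[4]: simple tensors ⊗(v_{ijk}) such that for
  -- some 1≤x<y<z<t≤4 (necessarily (1,2,3,4)) v_{xyz}=v_{xyt}=v_{xzt}=v_{yzt}
  record EGen (w : T4) : Set (c ⊔ ℓ) where
    field
      v123 v124 v134 v234 : V
      eq₁ : v123 ≈V v124
      eq₂ : v124 ≈V v134
      eq₃ : v134 ≈V v234
      isT : w ≡ t v123 v124 v134 v234

  E4 : T4 → Set (c ⊔ ℓ)
  E4 = Span EGen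

  sumT : List T4 → T4
  sumT = foldr _⊕_ zeroT

  six : V → V → V → T4
  six a b c' = t a a b c' ⊕ t a b a c' ⊕ t a b c' a
             ⊕ t b a a c' ⊕ t b a c' a ⊕ t b c' a a

  v0 v1 v2 v3 : Fin 4
  v0 = Fin.zero
  v1 = Fin.suc Fin.zero
  v2 = Fin.suc (Fin.suc Fin.zero)
  v3 = Fin.suc (Fin.suc (Fin.suc Fin.zero))

  mk4 : {A : Set} → A → A → A → A → Fin 4 → A
  mk4 a b c' d' Fin.zero = a
  mk4 a b c' d' (Fin.suc Fin.zero) = b
  mk4 a b c' d' (Fin.suc (Fin.suc Fin.zero)) = c'
  mk4 a b c' d' (Fin.suc (Fin.suc (Fin.suc Fin.zero))) = d'

  perms4 : List (Fin 4 → Fin 4)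
  perms4 =
      mk4 v0 v1 v2 v3 ∷ mk4 v0 v1 v3 v2 ∷ mk4 v0 v2 v1 v3 ∷ mk4 v0 v2 v3 v1
    ∷ mk4 v0 v3 v1 v2 ∷ mk4 v0 v3 v2 v1 ∷ mk4 v1 v0 v2 v3 ∷ mk4 v1 v0 v3 v2
    ∷ mk4 v1 v2 v0 v3 ∷ mk4 v1 v2 v3 v0 ∷ mk4 v1 v3 v0 v2 ∷ mk4 v1 v3 v2 v0
    ∷ mk4 v2 v0 v1 v3 ∷ mk4 v2 v0 v3 v1 ∷ mk4 v2 v1 v0 v3 ∷ mk4 v2 v1 v3 v0
    ∷ mk4 v2 v3 v0 v1 ∷ mk4 v2 v3 v1 v0 ∷ mk4 v3 v0 v1 v2 ∷ mk4 v3 v0 v2 v1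
    ∷ mk4 v3 v1 v0 v2 ∷ mk4 v3 v1 v2 v0 ∷ mk4 v3 v2 v0 v1 ∷ mk4 v3 v2 v1 v0 ∷ []

  data Gen : T4 → Set c where
    gen1 : (i : Fin d) → Gen (t (e i) (e i) (e i) (e i))
    gen2 : (i j : Fin d) → ¬ (i ≡ j) →
           Gen (t (e i) (e i) (e i) (e j) ⊕ t (e i) (e i) (e j) (e i)
                ⊕ t (e i) (e j) (e i) (e i) ⊕ t (e j) (e i) (e i) (e i))
    gen3 : (i j : Fin d) → i < j →
           Gen (t (e i) (e i) (e j) (e j) ⊕ t (e i) (e j) (e i) (e j)
                ⊕ t (e i) (e j) (e j) (e i) ⊕ t (e j) (e i) (e i) (e j)
                ⊕ t (e j) (e i) (e j) (e i) ⊕ t (e j) (e j) (e i) (e i))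
    gen4 : (i j k : Fin d) → j < k → ¬ (i ≡ j) → ¬ (i ≡ k) →
           Gen (six (e i) (e j) (e k) ⊕ six (e i) (e k) (e j))
    gen5 : (i j k l : Fin d) → i < j → j < k → k < l →
           Gen (sumT (map (λ σ → t (e (mk4 i j k l (σ v0))) (e (mk4 i j k l (σ v1)))
                                    (e (mk4 i j k l (σ v2))) (e (mk4 i j k l (σ v3))))
                          perms4))

-- E[4] is spanned by the fourth powers a ⊗ a ⊗ a ⊗ a. Write S(a,b,c,d) for the
-- sum of the 24 permuted tensors t(a_σ,b_σ,c_σ,d_σ). By polarisation,
-- S(a,b,c,d) = Σ_{T ⊆ {a,b,c,d}} (-1)^|T| (Σ T)^⊗4, so every S lies in E[4].
-- Conversely S(a,a,a,a) = 24 a^⊗4 and S is symmetric and multilinear, so a^⊗4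
-- lies in the span of the S(e_i,e_j,e_k,e_l) with i ≤ j ≤ k ≤ l; these are
-- 24, 6, 4, 2 and 1 times the generators (1)–(5).

{-# OPTIONS --safe #-}
module Submission where

open import Defs
open import Level using (Level)
open import Algebra.Bundles using (CommutativeRing)
open import Data.Nat using (ℕ)
import Data.Nat as ℕ
open import Data.Product using (_×_; Σ; _,_; proj₁; proj₂)
open import Data.Sum using (inj₁; inj₂)
open import Data.Fin as Fin using (Fin; _<_; combine)
open import Data.Fin.Patterns using (0F; 1F; 2F; 3F; 4F; 5F)
open import Data.Fin.Properties using (<-cmp; <-trans; <⇒≢)
open import Data.List as List using ()
open import Data.Vec using (Vec; []; _∷_)
open import Function using (_∘′_)
open import Data.Bool using (if_then_else_)
open import Relation.Nullary using (does)
open import Relation.Binary.Core using (Rel)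
open import Relation.Binary.Definitions using (Total)
open import Relation.Binary.Construct.Closure.Reflexive using (ReflClosure; [_])
import Relation.Binary.Construct.Closure.Reflexive as Refl
import Relation.Binary.Construct.Closure.Reflexive.Properties as ReflProperties
import Relation.Binary.PropositionalEquality as ≡
open ≡ using (_≡_)

module _ {a ℓ p} {A : Set a} {_≤_ : Rel A ℓ} (total : Total _≤_)
         {P : A → A → A → A → Set p}
         (swap₀₁ : ∀ {i j k l} → P i j k l → P j i k l)
         (swap₁₂ : ∀ {i j k l} → P i j k l → P i k j l)
         (swap₂₃ : ∀ {i j k l} → P i j k l → P i j l k)
         (sorted : ∀ {i j k l} → i ≤ j → j ≤ k → k ≤ l → P i j k l)
         where

  private
    insert : ∀ i {j k l} → j ≤ k → k ≤ l → P i j k l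
    insert i {j} {k} {l} j≤k k≤l with total i j
    ... | inj₁ i≤j = sorted i≤j j≤k k≤l
    ... | inj₂ j≤i with total i k
    ...   | inj₁ i≤k = swap₀₁ (sorted j≤i i≤k k≤l)
    ...   | inj₂ k≤i with total i l
    ...     | inj₁ i≤l = swap₀₁ (swap₁₂ (sorted j≤k k≤i i≤l))
    ...     | inj₂ l≤i = swap₀₁ (swap₁₂ (swap₂₃ (sorted j≤k k≤l l≤i)))

    sort₃ : ∀ i j {k l} → k ≤ l → P i j k l
    sort₃ i j {k} {l} k≤l with total j k
    ... | inj₁ j≤k = insert i j≤k k≤l
    ... | inj₂ k≤j with total j l
    ...   | inj₁ j≤l = swap₁₂ (insert i k≤j j≤l)
    ...   | inj₂ l≤j = swap₁₂ (swap₂₃ (insert i k≤l l≤j))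

  all-from-sorted : ∀ i j k l → P i j k l
  all-from-sorted i j k l with total k l
  ... | inj₁ k≤l = sort₃ i j k≤l
  ... | inj₂ l≤k = swap₂₃ (sort₃ i j l≤k)

module FourthPowers {c ℓ : Level} (R : CommutativeRing c ℓ) (d : ℕ) where
  open CommutativeRing R
  open Tensor R d using (V; T4; _≈V_; _≋_; e; perms4; Span; span-zero; span-gen;
                         span-add; span-scale; span-resp; EGen; Gen;
                         gen1; gen2; gen3; gen4; gen5)
  open import Algebra.Properties.Ring ring using (-1*x≈-x)
  open import Algebra.Properties.Monoid.Sum +-monoid using (sum; sum-cong-≋; sum-replicate-zero)
  open import Algebra.Solver.Ring.NaturalCoefficients.Default commutativeSemiring
  open import Relation.Binary.Reasoning.Setoid setoid

  ≋-sym : ∀ {u v} → u ≋ v → v ≋ u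
  ≋-sym u≋v p q r s = sym (u≋v p q r s)

  -- The operations of Tensor R d over an arbitrary signature, so that they can
  -- also be evaluated on the ring solver's polynomial expressions.
  module Forms {a} {A : Set a} (_+_ _*_ : A → A → A) (0# 1# : A) (I : Set) where

    Vector Form : Set a
    Vector = I → A
    Form   = I → I → I → I → A

    infixl 6 _+ᵥ_ _⊕_
    infixr 7 _*ᵥ_ _·_

    0ᵥ : Vector
    0ᵥ _ = 0#

    _+ᵥ_ : Vector → Vector → Vector
    (u +ᵥ v) i = u i + v i

    _*ᵥ_ : A → Vector → Vector
    (x *ᵥ v) i = x * v i

    zeroT : Form
    zeroT _ _ _ _ = 0#

    _⊕_ : Form → Form → Form
    (u ⊕ v) p q r s = u p q r s + v p q r s

    _·_ : A → Form → Form
    (x · u) p q r s = x * u p q r s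

    t : Vector → Vector → Vector → Vector → Form
    t a b c d p q r s = ((a p * b q) * c r) * d s

    diag : Vector → Form
    diag a = t a a a a

    select : Vector → Vector → Vector → Vector → Fin 4 → Vector
    select a b c d 0F = a
    select a b c d 1F = b
    select a b c d 2F = c
    select a b c d 3F = d

    permuted : (Fin 4 → Vector) → (Fin 4 → Fin 4) → Form
    permuted x σ = t (x (σ 0F)) (x (σ 1F)) (x (σ 2F)) (x (σ 3F))

    S : Vector → Vector → Vector → Vector → Form
    S a b c d = List.foldr _⊕_ zeroT (List.map (permuted (select a b c d)) perms4)

    sym₃₁ sym₂₂ : Vector → Vector → Form
    sym₃₁ a b = t a a a b ⊕ t a a b a ⊕ t a b a a ⊕ t b a a a
    sym₂₂ a b = t a a b b ⊕ t a b a b ⊕ t a b b a ⊕ t b a a b ⊕ t b a b a ⊕ t b b a a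

    six : Vector → Vector → Vector → Form
    six a b c = t a a b c ⊕ t a b a c ⊕ t a b c a ⊕ t b a a c ⊕ t b a c a ⊕ t b c a a

    sym₂₁₁ : Vector → Vector → Vector → Form
    sym₂₁₁ a b c = six a b c ⊕ six a c b

    -- polar⁺ vs acc / polar⁻ vs acc: sum of diag (acc + Σ T) over the subsets T
    -- of vs of even / odd size.
    polar⁺ polar⁻ : ∀ {m} → Vec Vector m → Vector → Form
    polar⁺ []       acc = diag acc
    polar⁺ (v ∷ vs) acc = polar⁺ vs acc ⊕ polar⁻ vs (acc +ᵥ v)
    polar⁻ []       acc = zeroT
    polar⁻ (v ∷ vs) acc = polar⁻ vs acc ⊕ polar⁺ vs (acc +ᵥ v)

    two three : A
    two   = 1# + 1#
    three = two + 1#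

  open Forms _+_ _*_ 0# 1# (Fin d) public
  module P {n} = Forms (_:+_ {n}) _:*_ (con 0) (con 1) (Fin 4)

  -- The (p,q,r,s) coordinate of a form in n vectors vᵢ is a polynomial in the 4n
  -- values vᵢ p, vᵢ q, vᵢ r, vᵢ s. The symbolic vector X i carries these values as
  -- variables, in the order of coords, and ⟪_⟫ reads off the coordinate (p,q,r,s),
  -- relabelled (0,1,2,3).
  module Symbolic (n : ℕ) where
    X : Fin n → Fin 4 → Polynomial (n ℕ.* 4)
    X i k = var (combine i k)

  coords : ∀ {n} → Vec V n → Fin d → Fin d → Fin d → Fin d → Vec Carrier (n ℕ.* 4)
  coords []       p q r s = []
  coords (v ∷ vs) p q r s = v p ∷ v q ∷ v r ∷ v s ∷ coords vs p q r s

  ⟪_⟫ : ∀ {n} → P.Form {n} → Polynomial n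
  ⟪ u ⟫ = u 0F 1F 2F 3F

  ⟦_⟧ₜ : ∀ {n} → Polynomial (n ℕ.* 4) → Vec V n → T4
  ⟦ f ⟧ₜ vs p q r s = ⟦ f ⟧ (coords vs p q r s)

  ≋-by-normalisation : ∀ {n} (vs : Vec V n) (f g : Polynomial (n ℕ.* 4)) →
                       normalise f ≡ normalise g → ⟦ f ⟧ₜ vs ≋ ⟦ g ⟧ₜ vs
  ≋-by-normalisation vs f g f≡g p q r s =
    prove (coords vs p q r s) f g (reflexive (≡.cong (λ N → ⟦ N ⟧N (coords vs p q r s)) f≡g))

  S-swap₀₁ : ∀ a b c d → S a b c d ≋ S b a c d
  S-swap₀₁ a b c d = ≋-by-normalisation (a ∷ b ∷ c ∷ d ∷ [])
    ⟪ P.S (X 0F) (X 1F) (X 2F) (X 3F) ⟫ ⟪ P.S (X 1F) (X 0F) (X 2F) (X 3F) ⟫ ≡.refl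
    where open Symbolic 4

  S-swap₁₂ : ∀ a b c d → S a b c d ≋ S a c b d
  S-swap₁₂ a b c d = ≋-by-normalisation (a ∷ b ∷ c ∷ d ∷ [])
    ⟪ P.S (X 0F) (X 1F) (X 2F) (X 3F) ⟫ ⟪ P.S (X 0F) (X 2F) (X 1F) (X 3F) ⟫ ≡.refl
    where open Symbolic 4

  S-swap₂₃ : ∀ a b c d → S a b c d ≋ S a b d c
  S-swap₂₃ a b c d = ≋-by-normalisation (a ∷ b ∷ c ∷ d ∷ [])
    ⟪ P.S (X 0F) (X 1F) (X 2F) (X 3F) ⟫ ⟪ P.S (X 0F) (X 1F) (X 3F) (X 2F) ⟫ ≡.refl
    where open Symbolic 4

  S-zeroˡ : ∀ b c d → S 0ᵥ b c d ≋ zeroT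
  S-zeroˡ b c d = ≋-by-normalisation (b ∷ c ∷ d ∷ [])
    ⟪ P.S P.0ᵥ (X 0F) (X 1F) (X 2F) ⟫ ⟪ P.zeroT ⟫ ≡.refl
    where open Symbolic 3

  S-linearˡ : ∀ x a a′ b c d → S (x *ᵥ a +ᵥ a′) b c d ≋ (x · S a b c d ⊕ S a′ b c d)
  S-linearˡ x a a′ b c d = ≋-by-normalisation (a ∷ a′ ∷ b ∷ c ∷ d ∷ (λ _ → x) ∷ [])
    ⟪ P.S (X 5F 0F P.*ᵥ X 0F P.+ᵥ X 1F) (X 2F) (X 3F) (X 4F) ⟫
    ⟪ X 5F 0F P.· P.S (X 0F) (X 2F) (X 3F) (X 4F) P.⊕ P.S (X 1F) (X 2F) (X 3F) (X 4F) ⟫ ≡.refl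
    where open Symbolic 6  -- the scalar x enters as the constant vector X 5F

  S-polarisation : ∀ a b c d →
    (S a b c d ⊕ polar⁻ (a ∷ b ∷ c ∷ d ∷ []) 0ᵥ) ≋ polar⁺ (a ∷ b ∷ c ∷ d ∷ []) 0ᵥ
  S-polarisation a b c d = ≋-by-normalisation (a ∷ b ∷ c ∷ d ∷ [])
    ⟪ P.S (X 0F) (X 1F) (X 2F) (X 3F) P.⊕ P.polar⁻ (X 0F ∷ X 1F ∷ X 2F ∷ X 3F ∷ []) P.0ᵥ ⟫
    ⟪ P.polar⁺ (X 0F ∷ X 1F ∷ X 2F ∷ X 3F ∷ []) P.0ᵥ ⟫ ≡.refl
    where open Symbolic 4

  S-diag : ∀ a → S a a a a ≋ (two · two · two · three · diag a)
  S-diag a = ≋-by-normalisation (a ∷ [])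
    ⟪ P.S (X 0F) (X 0F) (X 0F) (X 0F) ⟫ ⟪ P.two P.· P.two P.· P.two P.· P.three P.· P.diag (X 0F) ⟫ ≡.refl
    where open Symbolic 1

  S-sym₃₁ : ∀ a b → S a a a b ≋ (two · three · sym₃₁ a b)
  S-sym₃₁ a b = ≋-by-normalisation (a ∷ b ∷ [])
    ⟪ P.S (X 0F) (X 0F) (X 0F) (X 1F) ⟫ ⟪ P.two P.· P.three P.· P.sym₃₁ (X 0F) (X 1F) ⟫ ≡.refl
    where open Symbolic 2

  S-sym₂₂ : ∀ a b → S a a b b ≋ (two · two · sym₂₂ a b)
  S-sym₂₂ a b = ≋-by-normalisation (a ∷ b ∷ [])
    ⟪ P.S (X 0F) (X 0F) (X 1F) (X 1F) ⟫ ⟪ P.two P.· P.two P.· P.sym₂₂ (X 0F) (X 1F) ⟫ ≡.refl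
    where open Symbolic 2

  S-sym₂₁₁ : ∀ a b c → S a a b c ≋ (two · sym₂₁₁ a b c)
  S-sym₂₁₁ a b c = ≋-by-normalisation (a ∷ b ∷ c ∷ [])
    ⟪ P.S (X 0F) (X 0F) (X 1F) (X 2F) ⟫ ⟪ P.two P.· P.sym₂₁₁ (X 0F) (X 1F) (X 2F) ⟫ ≡.refl
    where open Symbolic 3

  module _ {p} {P : T4 → Set p} where

    span-⊆ : ∀ {q} {Q : T4 → Set q} → (∀ {u} → P u → Span Q u) → ∀ {u} → Span P u → Span Q u
    span-⊆ P⊆ span-zero          = span-zero
    span-⊆ P⊆ (span-gen Pu)      = P⊆ Pu
    span-⊆ P⊆ (span-add su sv)   = span-add (span-⊆ P⊆ su) (span-⊆ P⊆ sv)
    span-⊆ P⊆ (span-scale x su)  = span-scale x (span-⊆ P⊆ su)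
    span-⊆ P⊆ (span-resp u≋v su) = span-resp u≋v (span-⊆ P⊆ su)

    span-unscale : ∀ {x y u} → x * y ≈ 1# → Span P (x · u) → Span P u
    span-unscale {x} {y} {u} x*y≈1 = span-resp y·x·u≋u ∘′ span-scale y
      where
      y·x·u≋u : (y · x · u) ≋ u
      y·x·u≋u p q r s = begin
        y * (x * u p q r s) ≈⟨ *-assoc y x _ ⟨
        y * x * u p q r s   ≈⟨ *-congʳ (trans (*-comm y x) x*y≈1) ⟩
        1# * u p q r s      ≈⟨ *-identityˡ _ ⟩
        u p q r s           ∎

    span-cancelʳ : ∀ {u v w} → (u ⊕ v) ≋ w → Span P v → Span P w → Span P u
    span-cancelʳ {u} {v} {w} u⊕v≋w sv sw = span-resp w-v≋u (span-add sw (span-scale (- 1#) sv))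
      where
      w-v≋u : (w ⊕ - 1# · v) ≋ u
      w-v≋u p q r s = begin
        w p q r s + - 1# * v p q r s          ≈⟨ +-cong (sym (u⊕v≋w p q r s)) (-1*x≈-x _) ⟩
        u p q r s + v p q r s + - v p q r s    ≈⟨ +-assoc _ _ _ ⟩
        u p q r s + (v p q r s + - v p q r s)  ≈⟨ +-congˡ (-‿inverseʳ _) ⟩
        u p q r s + 0#                         ≈⟨ +-identityʳ _ ⟩
        u p q r s                              ∎

    span-swap₀₁ : ∀ {a b c d} → Span P (S a b c d) → Span P (S b a c d)
    span-swap₀₁ = span-resp (S-swap₀₁ _ _ _ _)

    span-swap₁₂ : ∀ {a b c d} → Span P (S a b c d) → Span P (S a c b d)
    span-swap₁₂ = span-resp (S-swap₁₂ _ _ _ _)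

    span-swap₂₃ : ∀ {a b c d} → Span P (S a b c d) → Span P (S a b d c)
    span-swap₂₃ = span-resp (S-swap₂₃ _ _ _ _)

    span-rotate : ∀ {a b c d} → Span P (S b c d a) → Span P (S a b c d)
    span-rotate = span-swap₀₁ ∘′ span-swap₁₂ ∘′ span-swap₂₃

  t-cong : ∀ {a a′ b b′ c c′ d d′} → a ≈V a′ → b ≈V b′ → c ≈V c′ → d ≈V d′ →
           t a b c d ≋ t a′ b′ c′ d′
  t-cong a≈ b≈ c≈ d≈ p q r s = *-cong (*-cong (*-cong (a≈ p) (b≈ q)) (c≈ r)) (d≈ s)

  S-congˡ : ∀ {a a′} b c d → a ≈V a′ → S a b c d ≋ S a′ b c d
  S-congˡ {a} {a′} b c d a≈a′ = sum-cong perms4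
    where
    select-cong : ∀ k → select a b c d k ≈V select a′ b c d k
    select-cong 0F = a≈a′
    select-cong 1F = λ _ → refl
    select-cong 2F = λ _ → refl
    select-cong 3F = λ _ → refl

    sum-cong : ∀ σs → List.foldr _⊕_ zeroT (List.map (permuted (select a b c d)) σs)
                    ≋ List.foldr _⊕_ zeroT (List.map (permuted (select a′ b c d)) σs)
    sum-cong List.[]       p q r s = refl
    sum-cong (σ List.∷ σs) p q r s =
      +-cong (t-cong (select-cong (σ 0F)) (select-cong (σ 1F)) (select-cong (σ 2F))
                     (select-cong (σ 3F)) p q r s)
             (sum-cong σs p q r s)

  sum-δ : ∀ {n} (f : Fin n → Carrier) (j : Fin n) →
          sum (λ i → f i * (if does (i Fin.≟ j) then 1# else 0#)) ≈ f j
  sum-δ {ℕ.suc n} f 0F = begin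
    f 0F * 1# + sum (λ i → f (Fin.suc i) * 0#) ≈⟨ +-cong (*-identityʳ _) sum-zero ⟩
    f 0F + 0#                                    ≈⟨ +-identityʳ _ ⟩
    f 0F                                         ∎
    where
    sum-zero : sum (λ i → f (Fin.suc i) * 0#) ≈ 0#
    sum-zero = trans (sum-cong-≋ {n} (λ i → zeroʳ (f (Fin.suc i)))) (sum-replicate-zero n)
  sum-δ {ℕ.suc n} f (Fin.suc j) =
    trans (+-cong (zeroʳ _) (sum-δ (f ∘′ Fin.suc) j)) (+-identityˡ _)

  module _ {p} {P : T4 → Set p} where

    S-lincombˡ : ∀ {n} (y : Fin n → Carrier) (u : Fin n → V) {b c d} →
                 (∀ i → Span P (S (u i) b c d)) →
                 Span P (S (λ k → sum (λ i → y i * u i k)) b c d)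
    S-lincombˡ {ℕ.zero}  y u {b} {c} {d} _ = span-resp (≋-sym (S-zeroˡ b c d)) span-zero
    S-lincombˡ {ℕ.suc n} y u {b} {c} {d} h =
      span-resp (≋-sym (S-linearˡ (y 0F) (u 0F) _ b c d))
        (span-add (span-scale (y 0F) (h 0F))
                  (S-lincombˡ (y ∘′ Fin.suc) (u ∘′ Fin.suc) (λ i → h (Fin.suc i))))

    S-from-basisˡ : ∀ {a b c d} → (∀ i → Span P (S (e i) b c d)) → Span P (S a b c d)
    S-from-basisˡ {a} {b} {c} {d} h =
      span-resp (S-congˡ b c d (sum-δ a)) (S-lincombˡ a e h)

    S-from-basis : (∀ i j k l → Span P (S (e i) (e j) (e k) (e l))) →
                   ∀ a b c d → Span P (S a b c d)
    S-from-basis h a b c d =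
      S-from-basisˡ λ i → span-rotate (S-from-basisˡ λ j → span-rotate (
      S-from-basisˡ λ k → span-rotate (S-from-basisˡ λ l → span-rotate (h i j k l))))

    module _ (diag∈ : ∀ a → Span P (diag a)) where

      polar⁺∈ : ∀ {m} (vs : Vec V m) acc → Span P (polar⁺ vs acc)
      polar⁻∈ : ∀ {m} (vs : Vec V m) acc → Span P (polar⁻ vs acc)
      polar⁺∈ []       acc = diag∈ acc
      polar⁺∈ (v ∷ vs) acc = span-add (polar⁺∈ vs acc) (polar⁻∈ vs (acc +ᵥ v))
      polar⁻∈ []       acc = span-zero
      polar⁻∈ (v ∷ vs) acc = span-add (polar⁻∈ vs acc) (polar⁺∈ vs (acc +ᵥ v))

      S-from-diag : ∀ a b c d → Span P (S a b c d)
      S-from-diag a b c d = span-cancelʳ (S-polarisation a b c d)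
        (polar⁻∈ (a ∷ b ∷ c ∷ d ∷ []) 0ᵥ) (polar⁺∈ (a ∷ b ∷ c ∷ d ∷ []) 0ᵥ)

  _⊑_ : Rel (Fin d) _
  _⊑_ = ReflClosure _<_

  Sₑ-sorted : ∀ {i j k l} → i ⊑ j → j ⊑ k → k ⊑ l → Span Gen (S (e i) (e j) (e k) (e l))
  Sₑ-sorted {i} Refl.refl Refl.refl Refl.refl =
    span-resp (≋-sym (S-diag (e i)))
      (span-scale two (span-scale two (span-scale two (span-scale three (span-gen (gen1 i))))))
  Sₑ-sorted {i} {l = l} Refl.refl Refl.refl [ k<l ] =
    span-resp (≋-sym (S-sym₃₁ (e i) (e l)))
      (span-scale two (span-scale three (span-gen (gen2 i l (<⇒≢ k<l)))))
  Sₑ-sorted {i} {j} [ i<j ] Refl.refl Refl.refl =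
    span-rotate (span-resp (≋-sym (S-sym₃₁ (e j) (e i)))
      (span-scale two (span-scale three (span-gen (gen2 j i (≡.≢-sym (<⇒≢ i<j)))))))
  Sₑ-sorted {i} {k = k} Refl.refl [ j<k ] Refl.refl =
    span-resp (≋-sym (S-sym₂₂ (e i) (e k)))
      (span-scale two (span-scale two (span-gen (gen3 i k j<k))))
  Sₑ-sorted {i} {k = k} {l} Refl.refl [ j<k ] [ k<l ] =
    span-resp (≋-sym (S-sym₂₁₁ (e i) (e k) (e l)))
      (span-scale two (span-gen (gen4 i k l k<l (<⇒≢ j<k) (<⇒≢ (<-trans j<k k<l)))))
  Sₑ-sorted {i} {j} {l = l} [ i<j ] Refl.refl [ k<l ] =
    span-swap₀₁ (span-swap₁₂ (span-resp (≋-sym (S-sym₂₁₁ (e j) (e i) (e l)))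
      (span-scale two (span-gen (gen4 j i l (<-trans i<j k<l) (≡.≢-sym (<⇒≢ i<j)) (<⇒≢ k<l))))))
  Sₑ-sorted {i} {j} {k} [ i<j ] [ j<k ] Refl.refl =
    span-rotate (span-rotate (span-resp (≋-sym (S-sym₂₁₁ (e k) (e i) (e j)))
      (span-scale two (span-gen (gen4 k i j i<j (≡.≢-sym (<⇒≢ (<-trans i<j j<k)))
                                               (≡.≢-sym (<⇒≢ j<k)))))))
  Sₑ-sorted {i} {j} {k} {l} [ i<j ] [ j<k ] [ k<l ] = span-gen (gen5 i j k l i<j j<k k<l)

  Sₑ∈⟨Gen⟩ : ∀ i j k l → Span Gen (S (e i) (e j) (e k) (e l))
  Sₑ∈⟨Gen⟩ = all-from-sorted (ReflProperties.total <-cmp)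
    {P = λ i j k l → Span Gen (S (e i) (e j) (e k) (e l))}
    span-swap₀₁ span-swap₁₂ span-swap₂₃ Sₑ-sorted

  diag∈⟨EGen⟩ : ∀ a → Span EGen (diag a)
  diag∈⟨EGen⟩ a = span-gen (record
    { v123 = a ; v124 = a ; v134 = a ; v234 = a
    ; eq₁ = λ _ → refl ; eq₂ = λ _ → refl ; eq₃ = λ _ → refl ; isT = ≡.refl })

  S∈⟨EGen⟩ : ∀ a b c d → Span EGen (S a b c d)
  S∈⟨EGen⟩ = S-from-diag diag∈⟨EGen⟩

  module _ (2⁻¹ : Σ Carrier λ y → two * y ≈ 1#) (3⁻¹ : Σ Carrier λ y → three * y ≈ 1#) where

    private
      ½ : ∀ {p} {P : T4 → Set p} {u} → Span P (two · u) → Span P u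
      ½ = span-unscale (proj₂ 2⁻¹)

      ⅓ : ∀ {p} {P : T4 → Set p} {u} → Span P (three · u) → Span P u
      ⅓ = span-unscale (proj₂ 3⁻¹)

    diag∈⟨Gen⟩ : ∀ a → Span Gen (diag a)
    diag∈⟨Gen⟩ a = ⅓ (½ (½ (½ (span-resp (S-diag a) (S-from-basis Sₑ∈⟨Gen⟩ a a a a)))))

    EGen⊆⟨Gen⟩ : ∀ {w} → EGen w → Span Gen w
    EGen⊆⟨Gen⟩ g = ≡.subst (Span Gen) (≡.sym isT) (span-resp v123⁴≋t (diag∈⟨Gen⟩ v123))
      where
      open EGen g
      v123⁴≋t : diag v123 ≋ t v123 v124 v134 v234
      v123⁴≋t = t-cong (λ _ → refl) eq₁ (λ p → trans (eq₁ p) (eq₂ p))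
                       (λ p → trans (eq₁ p) (trans (eq₂ p) (eq₃ p)))

    Gen⊆⟨EGen⟩ : ∀ {w} → Gen w → Span EGen w
    Gen⊆⟨EGen⟩ (gen1 i)           = diag∈⟨EGen⟩ (e i)
    Gen⊆⟨EGen⟩ (gen2 i j _)       = ⅓ (½ (span-resp (S-sym₃₁ (e i) (e j)) (S∈⟨EGen⟩ _ _ _ _)))
    Gen⊆⟨EGen⟩ (gen3 i j _)       = ½ (½ (span-resp (S-sym₂₂ (e i) (e j)) (S∈⟨EGen⟩ _ _ _ _)))
    Gen⊆⟨EGen⟩ (gen4 i j k _ _ _) = ½ (span-resp (S-sym₂₁₁ (e i) (e j) (e k)) (S∈⟨EGen⟩ _ _ _ _))
    Gen⊆⟨EGen⟩ (gen5 i j k l _ _ _) = S∈⟨EGen⟩ (e i) (e j) (e k) (e l)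

proposition3p3 : {c ℓ : Level} (R : CommutativeRing c ℓ) → IsField R → Infinite R →
    CharNot2 R → CharNot3 R → (d : ℕ) →
    let open Tensor R d in
    ∀ (w : T4) → (Span EGen w → Span Gen w) × (Span Gen w → Span EGen w)
proposition3p3 R isField _ char≠2 char≠3 d w =
  span-⊆ (EGen⊆⟨Gen⟩ 2⁻¹ 3⁻¹) , span-⊆ (Gen⊆⟨EGen⟩ 2⁻¹ 3⁻¹)
  where
  open FourthPowers R d
  open IsField isField
  open CommutativeRing R using (Carrier; _≈_; _*_; 1#)
  2⁻¹ : Σ Carrier λ y → two * y ≈ 1#
  2⁻¹ = inverse two char≠2
  3⁻¹ : Σ Carrier λ y → three * y ≈ 1#
  3⁻¹ = inverse three char≠3
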